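{- Let $\mathcal{P}$ be a finite poset, $m=\max_{p\in\mathcal{P}}(|{\downarrow}p|+|{\uparrow}p|)$, and let $\mathcal{A},\mathcal{B}$ be nonempty antichains of $\mathcal{L}(\mathcal{P})$ with $N=|\mathcal{A}|+|\mathcal{B}|$. If $\mathcal{A}$ and $\mathcal{B}$ are dual, then at least one of the following holds: (i) there is $p\in\mathcal{P}$ with $freq_{\mathcal{A}}(p)\ge \frac{1}{m\log_{4/3}N}$; (ii) there is $p\in\mathcal{P}$ with $freq_{\overline{\mathcal{B}}}(p)\ge\frac{1}{m^2\log_{4/3}N}$.
   Context: For a finite poset $\mathcal{P}$, $\mathcal{L}(\mathcal{P})$ denotes the lattice of all downsets of $\mathcal{P}$ ordered by inclusion; ${\downarrow}p$ is the smallest downset containing $p$ and ${\uparrow}p$ the smallest upset containing $p$. Antichains $\mathcal{A},\mathcal{B}$ of $\mathcal{L}(\mathcal{P})$ are dual if $A\not\subseteq B$ for all $A\in\mathcal{A}$, $B\in\mathcal{B}$, and for every downset $X$ there is $A\in\mathcal{A}$ with $A\subseteq X$ or $B\in\mathcal{B}$ with $X\subseteq B$. For a nonempty family $\mathcal{C}$ of subsets of $\mathcal{P}$, $freq_{\mathcal{C}}(p)=|\{C\in\mathcal{C}\mid p\in C\}|/|\mathcal{C}|$, and $\overline{\mathcal{C}}=\{\mathcal{P}\setminus C\mid C\in\mathcal{C}\}$, so $freq_{\overline{\mathcal{B}}}(p)=|\{B\in\mathcal{B}\mid p\notin B\}|/|\mathcal{B}|$. -}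

module Defs where

open import Data.Nat using (ℕ; _+_; _*_; _^_; _≤_; _⊔_)
open import Data.Fin using (Fin)
open import Data.Fin.Subset using (Subset; _∈_; _∉_; _⊆_)
open import Data.Fin.Subset.Properties using (_∈?_)
open import Data.List using (List; length; filter; allFin; foldr; map)
open import Data.List.Relation.Unary.All using (All)
open import Data.List.Relation.Unary.Unique.Propositional using (Unique)
import Data.List.Membership.Propositional as LM
open import Data.Product using (Σ; _×_)
open import Data.Sum using (_⊎_)
open import Relation.Binary.Core using (Rel)
open import Relation.Binary.Definitions using (Decidable)
open import Relation.Binary.Structures using (IsPartialOrder)
open import Relation.Binary.PropositionalEquality using (_≡_)
open import Relation.Nullary using (¬_; ¬?)
open import Level using (0ℓ)

record FinPoset (n : ℕ) : Set₁ where
  field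
    _≼_ : Rel (Fin n) 0ℓ
    _≼?_ : Decidable _≼_
    isPartialOrder : IsPartialOrder _≡_ _≼_

module _ {n : ℕ} (P : FinPoset n) where
  open FinPoset P

  -- downsets of P (elements of L(P)); a subset is a Vec Bool n
  IsDownset : Subset n → Set
  IsDownset X = ∀ (p q : Fin n) → q ≼ p → p ∈ X → q ∈ X

  downSize : Fin n → ℕ
  downSize p = length (filter (λ q → q ≼? p) (allFin n))

  upSize : Fin n → ℕ
  upSize p = length (filter (λ q → p ≼? q) (allFin n))

  -- m = max_p (|↓p| + |↑p|)  (0 if P is empty)
  mP : ℕ
  mP = foldr _⊔_ 0 (map (λ p → downSize p + upSize p) (allFin n))

  IsAntichainL : List (Subset n) → Set
  IsAntichainL 𝒜 = Unique 𝒜 × All IsDownset 𝒜 ×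
    (∀ {A A′} → A LM.∈ 𝒜 → A′ LM.∈ 𝒜 → A ⊆ A′ → A ≡ A′)

  Dual : List (Subset n) → List (Subset n) → Set
  Dual 𝒜 ℬ =
    (∀ {A B} → A LM.∈ 𝒜 → B LM.∈ ℬ → ¬ (A ⊆ B)) ×
    (∀ (X : Subset n) → IsDownset X →
       (Σ (Subset n) λ A → A LM.∈ 𝒜 × A ⊆ X) ⊎ (Σ (Subset n) λ B → B LM.∈ ℬ × X ⊆ B))

-- number of members of a family containing p  ( = freq_𝒞(p) · |𝒞| )
countIn : {n : ℕ} → List (Subset n) → Fin n → ℕ
countIn 𝒞 p = length (filter (λ C → p ∈? C) 𝒞)

-- number of members of a family not containing p ( = freq_{complement 𝒞}(p) · |𝒞| )
countOut : {n : ℕ} → List (Subset n) → Fin n → ℕ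
countOut 𝒞 p = length (filter (λ C → ¬? (p ∈? C)) 𝒞)

-- For naturals a ≥ 1, c, k ≥ 1 and N ≥ 2:
--   c / a ≥ 1 / (k · log_{4/3} N)
--   ⇔ a ≤ k · c · log_{4/3} N
--   ⇔ (4/3)^a ≤ N^(k·c)
--   ⇔ 4^a ≤ 3^a · N^(k·c).
-- FreqBound a c k N encodes "c/a ≥ 1/(k log_{4/3} N)" exactly, in ℕ.
FreqBound : (a c k N : ℕ) → Set
FreqBound a c k N = 4 ^ a ≤ 3 ^ a * N ^ (k * c)

{-# OPTIONS --safe #-}
module Submission where

-- Suppose no point is frequent in the sense of (i) or (ii); put m = mP P, N = |𝒜| + |ℬ|, and let
-- S ⊆ P be random, containing each point independently with probability 1/(2m).  The downset ↓S
-- contradicts duality unless one of the following N events occurs, each of probability < 1/N.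
--   * S ⊆ B, for B ∈ ℬ.  Every A ∈ 𝒜 meets ∁B, so some point of ∁B lies in at least |𝒜|/|∁B|
--     members of 𝒜; as (i) fails, |∁B| is so large that Pr[S ⊆ B] = (1 - 1/(2m))^|∁B| < 1/N.
--   * A ⊆ ↓S, for A ∈ 𝒜.  Every B ∈ ℬ misses a point of A, and as (ii) fails, |A| is large.  A
--     maximal set D ⊆ A of points without common upper bounds has |A| ≤ m²|D|, and A ⊆ ↓S needs
--     distinct points of S above the elements of D, of probability ≤ m^|D| (2m)^-|D| = 2^-|D| < 1/N.
-- Hence some S avoids all N events; it is found by the method of conditional expectations, with
-- the probabilities scaled to integer weights.

open import Defs
open import Data.Bool using (Bool; true; false)
open import Data.Empty using (⊥; ⊥-elim)
open import Data.Fin using (Fin; zero; suc)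
open import Data.Fin.Properties using (any?)
open import Data.Fin.Subset
  using (Subset; inside; outside; _∈_; _∉_; _⊆_; ∣_∣; ∁; ⁅_⁆; _∪_) renaming (⊥ to ∅)
open import Data.Fin.Subset.Properties
  using (_∈?_; drop-∷-⊆; ∪-identityˡ; ⊆-min; ∉⊥; ∣⊥∣≡0; x∈p∪q⁻; x∈⁅y⁆⇒x≡y; x∉p⇒x∈∁p)
open import Data.List
  using (List; []; _∷_; _++_; map; filter; length; allFin; tabulate; foldr; concatMap; cartesianProductWith)
open import Data.List.Extrema.Nat using (argmax; f[xs]≤f[argmax])
open import Data.List.Membership.Propositional using (lose) renaming (_∈_ to _∈ₗ_)
open import Data.List.Membership.Propositional.Properties
  using (∈-filter⁺; ∈-filter⁻; ∈-allFin; ∈-map⁺; ∈-++⁺ˡ; ∈-++⁺ʳ)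
open import Data.List.Properties
  using (length-++; length-map; filter-accept; filter-all; filter-none; filter-some; map-++)
open import Data.List.Relation.Binary.Sublist.Propositional
  using (_∷ʳ_; _∷_; []; ⊆-refl) renaming (_⊆_ to _⊑_)
open import Data.List.Relation.Binary.Sublist.Propositional.Properties
  using (All-resp-⊆; filter⁺; length-mono-≤)
open import Data.List.Relation.Unary.All as All using (All; []; _∷_)
import Data.List.Relation.Unary.All.Properties as AllP
open import Data.List.Relation.Unary.AllPairs using (AllPairs; []; _∷_)
open import Data.List.Relation.Unary.Any as Any using (Any; here; there)
import Data.List.Relation.Unary.Any.Properties as AnyP
open import Data.Nat
open import Data.Nat.ListAction using (sum)
open import Data.Nat.ListAction.Properties using (sum-++)
open import Data.Nat.Properties
open import Data.Nat.Tactic.RingSolver using (solve-∀)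
open import Algebra.Properties.CommutativeSemigroup *-commutativeSemigroup
  using (interchange; x∙yz≈y∙xz; x∙yz≈z∙yx; x∙yz≈y∙zx; x∙yz≈yx∙z; xy∙z≈y∙xz; xy∙z≈x∙zy)
open import Data.Product using (Σ; ∃; _×_; _,_; proj₁; proj₂)
open import Data.Sum using (_⊎_; inj₁; inj₂; [_,_]′)
import Data.Vec as Vec
open import Data.Vec using ([]; _∷_; here; there)
open import Data.Vec.Properties using (lookup⇒[]=; []=⇒lookup; lookup∘tabulate)
open import Data.Vec.Relation.Binary.Pointwise.Inductive using (Pointwise; []; _∷_)
open import Function using (_∘_)
open import Relation.Binary.PropositionalEquality
  using (_≡_; refl; sym; trans; cong; cong₂; subst; module ≡-Reasoning)
open import Relation.Binary.PropositionalEquality.Properties using (setoid)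
open import Relation.Binary.Structures using (IsPartialOrder)
open import Relation.Nullary using (¬_; Dec; yes; no; does; ¬?; contradiction)
open import Relation.Nullary.Decidable using (_×-dec_; dec-true; decidable-stable)
open import Relation.Unary using (Decidable)

count : {A : Set} {P : A → Set} → Decidable P → List A → ℕ
count P? xs = length (filter P? xs)

module _ {A : Set} {P Q : A → Set} (P? : Decidable P) (Q? : Decidable Q) where

  count-mono : (∀ {x} → P x → Q x) → ∀ {xs ys} → xs ⊑ ys → count P? xs ≤ count Q? ys
  count-mono P⇒Q xs⊑ys = length-mono-≤ (filter⁺ P? Q? (λ { refl → P⇒Q }) xs⊑ys)

module _ {A : Set} {P : A → Set} (P? : Decidable P) where

  count-∷ : ∀ x xs → count P? xs ≤ count P? (x ∷ xs)
  count-∷ x xs = count-mono P? P? (λ p → p) (x ∷ʳ ⊆-refl)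

  count-accept : ∀ {x} xs → P x → count P? (x ∷ xs) ≡ suc (count P? xs)
  count-accept xs px = cong length (filter-accept P? {xs = xs} px)

module _ {A : Set} {P Q R : A → Set} (P? : Decidable P) (Q? : Decidable Q) (R? : Decidable R) where

  count-⊎ : (∀ {x} → P x → Q x ⊎ R x) → ∀ xs → count P? xs ≤ count Q? xs + count R? xs
  count-⊎ split []       = z≤n
  count-⊎ split (x ∷ xs) with P? x
  ... | no _ = ≤-trans (count-⊎ split xs) (+-mono-≤ (count-∷ Q? x xs) (count-∷ R? x xs))
  ... | yes px with split px
  ...   | inj₁ qx = begin
    suc (count P? xs)                      ≤⟨ s≤s (count-⊎ split xs) ⟩
    suc (count Q? xs) + count R? xs        ≤⟨ +-monoʳ-≤ _ (count-∷ R? x xs) ⟩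
    suc (count Q? xs) + count R? (x ∷ xs)  ≡⟨ cong (_+ _) (count-accept Q? xs qx) ⟨
    count Q? (x ∷ xs) + count R? (x ∷ xs)  ∎
    where open ≤-Reasoning
  ...   | inj₂ rx = begin
    suc (count P? xs)                      ≤⟨ s≤s (count-⊎ split xs) ⟩
    suc (count Q? xs + count R? xs)        ≡⟨ +-suc _ _ ⟨
    count Q? xs + suc (count R? xs)        ≤⟨ +-monoˡ-≤ _ (count-∷ Q? x xs) ⟩
    count Q? (x ∷ xs) + suc (count R? xs)  ≡⟨ cong (_ +_) (count-accept R? xs rx) ⟨
    count Q? (x ∷ xs) + count R? (x ∷ xs)  ∎
    where open ≤-Reasoning

sum-map-≤ : {A : Set} (f : A → ℕ) {c : ℕ} {xs : List A} → All (λ x → f x ≤ c) xs →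
            sum (map f xs) ≤ length xs * c
sum-map-≤ f []             = z≤n
sum-map-≤ f (fx≤c ∷ fxs≤c) = +-mono-≤ fx≤c (sum-map-≤ f fxs≤c)

module _ {A B : Set} {R : B → A → Set} (R? : ∀ p → Decidable (R p)) where

  covered? : (ps : List B) → Decidable (λ x → Any (λ p → R p x) ps)
  covered? ps x = Any.any? (λ p → R? p x) ps

  count-covered≤sum : ∀ ps xs → count (covered? ps) xs ≤ sum (map (λ p → count (R? p) xs) ps)
  count-covered≤sum []       xs =
    ≤-reflexive (cong length (filter-none (covered? []) (All.universal (λ _ ()) xs)))
  count-covered≤sum (p ∷ ps) xs = begin
    count (covered? (p ∷ ps)) xs
      ≤⟨ count-⊎ (covered? (p ∷ ps)) (R? p) (covered? ps) Any.toSum xs ⟩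
    count (R? p) xs + count (covered? ps) xs
      ≤⟨ +-monoʳ-≤ _ (count-covered≤sum ps xs) ⟩
    sum (map (λ p → count (R? p) xs) (p ∷ ps)) ∎
    where open ≤-Reasoning

  length≤sum-count : ∀ ps xs → All (λ x → Any (λ p → R p x) ps) xs →
                     length xs ≤ sum (map (λ p → count (R? p) xs) ps)
  length≤sum-count ps xs all-covered = begin
    length xs                            ≡⟨ cong length (filter-all (covered? ps) all-covered) ⟨
    count (covered? ps) xs               ≤⟨ count-covered≤sum ps xs ⟩
    sum (map (λ p → count (R? p) xs) ps) ∎
    where open ≤-Reasoning

  pigeonhole : ∀ ps xs → All (λ x → Any (λ p → R p x) ps) xs → 1 ≤ length xs →
               ∃ λ p → length xs ≤ length ps * count (R? p) xs
  pigeonhole ps xs@(_ ∷ _) all-covered@(x-covered ∷ _) _ = p , (begin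
    length xs                            ≤⟨ length≤sum-count ps xs all-covered ⟩
    sum (map (λ p → count (R? p) xs) ps) ≤⟨ sum-map-≤ _ (f[xs]≤f[argmax] p₀ ps) ⟩
    length ps * count (R? p) xs          ∎)
    where
    open ≤-Reasoning
    p₀ = proj₁ (Any.satisfied x-covered)
    p = argmax (λ p → count (R? p) xs) p₀ ps

module _ {A : Set} (f : A → ℕ) where

  sum-map-*-const : ∀ {c d} {xs : List A} → All (λ x → f x * c ≡ d) xs → sum (map f xs) * c ≡ length xs * d
  sum-map-*-const                  []         = refl
  sum-map-*-const {c} {xs = x ∷ _} (eq ∷ eqs) =
    trans (*-distribʳ-+ c (f x) _) (cong₂ _+_ eq (sum-map-*-const eqs))

  sum-map-concatMap : {B : Set} (g : B → List A) (xs : List B) →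
                      sum (map f (concatMap g xs)) ≡ sum (map (λ x → sum (map f (g x))) xs)
  sum-map-concatMap g []       = refl
  sum-map-concatMap g (x ∷ xs) = begin
    sum (map f (g x ++ concatMap g xs))              ≡⟨ cong sum (map-++ f (g x) _) ⟩
    sum (map f (g x) ++ map f (concatMap g xs))      ≡⟨ sum-++ (map f (g x)) _ ⟩
    sum (map f (g x)) + sum (map f (concatMap g xs)) ≡⟨ cong (_ +_) (sum-map-concatMap g xs) ⟩
    sum (map f (g x)) + sum (map (λ x → sum (map f (g x))) xs) ∎
    where open ≡-Reasoning

  private
    *-sum-map-< : ∀ {N K} {xs : List A} → All (λ x → N * f x < K) xs →
                  N * sum (map f xs) + length xs ≤ length xs * K
    *-sum-map-< {N}          []           = ≤-reflexive (trans (+-identityʳ _) (*-zeroʳ N))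
    *-sum-map-< {N} {K} {x ∷ xs} (fx< ∷ fxs<) = begin
      N * (f x + sum (map f xs)) + suc (length xs)     ≡⟨ rearrange N (f x) (sum (map f xs)) (length xs) ⟩
      suc (N * f x) + (N * sum (map f xs) + length xs) ≤⟨ +-mono-≤ fx< (*-sum-map-< {N} fxs<) ⟩
      K + length xs * K                                ∎
      where
      open ≤-Reasoning
      rearrange : ∀ N a s l → N * (a + s) + suc l ≡ suc (N * a) + (N * s + l)
      rearrange = solve-∀

  sum-map-<-average : ∀ {K} (xs : List A) → 1 ≤ length xs → All (λ x → length xs * f x < K) xs →
                      sum (map f xs) < K
  sum-map-<-average {K} xs@(_ ∷ _) _ fxs< = *-cancelˡ-≤ (length xs) (begin
    length xs * suc (sum (map f xs))       ≡⟨ *-suc (length xs) _ ⟩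
    length xs + length xs * sum (map f xs) ≡⟨ +-comm (length xs) _ ⟩
    length xs * sum (map f xs) + length xs ≤⟨ *-sum-map-< {length xs} fxs< ⟩
    length xs * K                          ∎)
    where open ≤-Reasoning

length-cartesianProductWith : {A B C : Set} (f : A → B → C) (xs : List A) (ys : List B) →
                              length (cartesianProductWith f xs ys) ≡ length xs * length ys
length-cartesianProductWith f []       ys = refl
length-cartesianProductWith f (x ∷ xs) ys =
  trans (length-++ (map (f x) ys)) (cong₂ _+_ (length-map (f x) ys) (length-cartesianProductWith f xs ys))

∈⇒≤foldr-⊔ : ∀ {x xs} → x ∈ₗ xs → x ≤ foldr _⊔_ 0 xs
∈⇒≤foldr-⊔              (here refl) = m≤m⊔n _ _
∈⇒≤foldr-⊔ {xs = y ∷ _} (there x∈)  = ≤-trans (∈⇒≤foldr-⊔ x∈) (m≤n⊔m y _)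

-- Exponential inequalities

^-distribʳ-* : ∀ m n o → (m * n) ^ o ≡ m ^ o * n ^ o
^-distribʳ-* m n zero    = refl
^-distribʳ-* m n (suc o) = trans (cong (m * n *_) (^-distribʳ-* m n o)) (interchange m n (m ^ o) (n ^ o))

[m^n]^o≡[m^o]^n : ∀ m n o → (m ^ n) ^ o ≡ (m ^ o) ^ n
[m^n]^o≡[m^o]^n m n o = trans (^-*-assoc m n o) (trans (cong (m ^_) (*-comm n o)) (sym (^-*-assoc m o n)))

-- In rational terms: (y/x)^e ≤ z and a ≤ ec give (y/x)^a ≤ z^c.
pow-ratio-≤ : ∀ {x y z e a c} .{{_ : NonZero x}} → x ≤ y → y ^ e ≤ x ^ e * z → a ≤ e * c →
              y ^ a ≤ x ^ a * z ^ c
pow-ratio-≤ {x} {y} {z} {e} {a} {c} x≤y ratio a≤ec with d , a+d≡ec ← m≤n⇒∃[o]m+o≡n a≤ec =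
  *-cancelˡ-≤ (x ^ (e * c)) {{m^n≢0 x (e * c)}} (begin
    x ^ (e * c) * y ^ a           ≡⟨ cong (λ k → x ^ k * y ^ a) a+d≡ec ⟨
    x ^ (a + d) * y ^ a           ≡⟨ cong (_* y ^ a) (^-distribˡ-+-* x a d) ⟩
    x ^ a * x ^ d * y ^ a         ≤⟨ *-monoˡ-≤ (y ^ a) (*-monoʳ-≤ (x ^ a) (^-monoˡ-≤ d x≤y)) ⟩
    x ^ a * y ^ d * y ^ a         ≡⟨ xy∙z≈x∙zy (x ^ a) (y ^ d) (y ^ a) ⟩
    x ^ a * (y ^ a * y ^ d)       ≡⟨ cong (x ^ a *_) (^-distribˡ-+-* y a d) ⟨
    x ^ a * y ^ (a + d)           ≡⟨ cong (λ k → x ^ a * y ^ k) a+d≡ec ⟩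
    x ^ a * y ^ (e * c)           ≤⟨ *-monoʳ-≤ (x ^ a) y^ec≤ ⟩
    x ^ a * (x ^ (e * c) * z ^ c) ≡⟨ x∙yz≈y∙xz (x ^ a) (x ^ (e * c)) (z ^ c) ⟩
    x ^ (e * c) * (x ^ a * z ^ c) ∎)
  where
  open ≤-Reasoning
  y^ec≤ : y ^ (e * c) ≤ x ^ (e * c) * z ^ c
  y^ec≤ = begin
    y ^ (e * c)         ≡⟨ ^-*-assoc y e c ⟨
    (y ^ e) ^ c         ≤⟨ ^-monoˡ-≤ c ratio ⟩
    (x ^ e * z) ^ c     ≡⟨ ^-distribʳ-* (x ^ e) z c ⟩
    (x ^ e) ^ c * z ^ c ≡⟨ cong (_* z ^ c) (^-*-assoc x e c) ⟩
    x ^ (e * c) * z ^ c ∎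

3≤4 : 3 ≤ 4
3≤4 = n≤1+n 3

¬FreqBound⇒3^h*N^k<4^h : ∀ a c k N h → ¬ FreqBound a c k N → a ≤ h * c → 3 ^ h * N ^ k < 4 ^ h
¬FreqBound⇒3^h*N^k<4^h a c k N h ¬bound a≤hc = ≰⇒> λ 4^h≤ →
  ¬bound (subst (λ t → 4 ^ a ≤ 3 ^ a * t) (^-*-assoc N k c) (pow-ratio-≤ {e = h} {c = c} 3≤4 4^h≤ a≤hc))

3^h*N^M<4^h⇒N<2^k : ∀ h N M k → 3 ^ h * N ^ M < 4 ^ h → h ≤ k * M → N < 2 ^ k
3^h*N^M<4^h⇒N<2^k h N M k small h≤kM = ≰⇒> λ 2^k≤N →
  <⇒≱ small (pow-ratio-≤ {e = k} {c = M} 3≤4 (begin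
    4 ^ k         ≡⟨ ^-distribʳ-* 2 2 k ⟩
    2 ^ k * 2 ^ k ≤⟨ *-mono-≤ (^-monoˡ-≤ k (n≤1+n 2)) 2^k≤N ⟩
    3 ^ k * N     ∎) h≤kM)
  where open ≤-Reasoning

-- Bernoulli's inequality (1 + 1/r)^j ≥ 1 + j/r, with denominators cleared.
bernoulli : ∀ r j → r ^ j * (r + j) ≤ r * suc r ^ j
bernoulli r zero    =
  ≤-reflexive (trans (+-identityʳ (r + 0)) (trans (+-identityʳ r) (sym (*-identityʳ r))))
bernoulli r (suc j) = begin
  r * r ^ j * (r + suc j)   ≡⟨ xy∙z≈y∙xz r (r ^ j) (r + suc j) ⟩
  r ^ j * (r * (r + suc j)) ≤⟨ *-monoʳ-≤ (r ^ j) step ⟩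
  r ^ j * (suc r * (r + j)) ≡⟨ x∙yz≈y∙xz (r ^ j) (suc r) (r + j) ⟩
  suc r * (r ^ j * (r + j)) ≤⟨ *-monoʳ-≤ (suc r) (bernoulli r j) ⟩
  suc r * (r * suc r ^ j)   ≡⟨ x∙yz≈y∙xz (suc r) r (suc r ^ j) ⟩
  r * (suc r * suc r ^ j)   ∎
  where
  open ≤-Reasoning
  step : r * (r + suc j) ≤ suc r * (r + j)
  step = begin
    r * (r + suc j)     ≡⟨ cong (r *_) (+-suc r j) ⟩
    r * suc (r + j)     ≡⟨ *-suc r (r + j) ⟩
    r + r * (r + j)     ≤⟨ +-monoˡ-≤ _ (m≤m+n r j) ⟩
    r + j + r * (r + j) ∎

-- (1 - 1/(2m))^m ≤ 3/4, from bernoulli with r = 2m - 1 and j = m.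
bernoulli-¾ : ∀ m .{{_ : NonZero m}} → 4 * (m + pred m) ^ m ≤ 3 * suc (m + pred m) ^ m
bernoulli-¾ m@(suc m′) = *-cancelˡ-≤ r (begin
  r * (4 * r ^ m)       ≡⟨ x∙yz≈z∙yx r 4 (r ^ m) ⟩
  r ^ m * (4 * r)       ≤⟨ *-monoʳ-≤ (r ^ m) 4r≤3[r+m] ⟩
  r ^ m * (3 * (r + m)) ≡⟨ x∙yz≈y∙xz (r ^ m) 3 (r + m) ⟩
  3 * (r ^ m * (r + m)) ≤⟨ *-monoʳ-≤ 3 (bernoulli r m) ⟩
  3 * (r * suc r ^ m)   ≡⟨ x∙yz≈y∙xz 3 r (suc r ^ m) ⟩
  r * (3 * suc r ^ m)   ∎)
  where
  open ≤-Reasoning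
  r = m + m′
  4r≤3[r+m] : 4 * r ≤ 3 * (r + m)
  4r≤3[r+m] = subst (4 * r ≤_) (identity m′) (m≤m+n (4 * r) (2 + m′))
    where
    identity : ∀ m′ → 4 * (suc m′ + m′) + (2 + m′) ≡ 3 * ((suc m′ + m′) + suc m′)
    identity = solve-∀

3^h*N^m<4^h⇒r^h*N<[1+r]^h : ∀ h N m r → 3 ^ h * N ^ m < 4 ^ h → 4 * r ^ m ≤ 3 * suc r ^ m →
                           r ^ h * N < suc r ^ h
3^h*N^m<4^h⇒r^h*N<[1+r]^h h N m r small ¾ = ≰⇒> λ q^h≤ → <⇒≱ key (^-monoˡ-≤ m q^h≤)
  where
  open ≤-Reasoning
  q = suc r
  key : (r ^ h * N) ^ m < (q ^ h) ^ m
  key = *-cancelˡ-< (4 ^ h) _ _ (begin-strict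
    4 ^ h * (r ^ h * N) ^ m       ≡⟨ cong (4 ^ h *_) (^-distribʳ-* (r ^ h) N m) ⟩
    4 ^ h * ((r ^ h) ^ m * N ^ m) ≡⟨ *-assoc (4 ^ h) _ (N ^ m) ⟨
    4 ^ h * (r ^ h) ^ m * N ^ m   ≡⟨ cong (λ t → 4 ^ h * t * N ^ m) ([m^n]^o≡[m^o]^n r h m) ⟩
    4 ^ h * (r ^ m) ^ h * N ^ m   ≡⟨ cong (_* N ^ m) (^-distribʳ-* 4 (r ^ m) h) ⟨
    (4 * r ^ m) ^ h * N ^ m       ≤⟨ *-monoˡ-≤ (N ^ m) (^-monoˡ-≤ h ¾) ⟩
    (3 * q ^ m) ^ h * N ^ m       ≡⟨ cong (_* N ^ m) (^-distribʳ-* 3 (q ^ m) h) ⟩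
    3 ^ h * (q ^ m) ^ h * N ^ m   ≡⟨ cong (λ t → 3 ^ h * t * N ^ m) ([m^n]^o≡[m^o]^n q m h) ⟩
    3 ^ h * (q ^ h) ^ m * N ^ m   ≡⟨ xy∙z≈x∙zy (3 ^ h) _ (N ^ m) ⟩
    3 ^ h * (N ^ m * (q ^ h) ^ m) ≡⟨ *-assoc (3 ^ h) (N ^ m) _ ⟨
    3 ^ h * N ^ m * (q ^ h) ^ m   <⟨ *-monoˡ-< ((q ^ h) ^ m) {{m^n≢0 (q ^ h) m {{m^n≢0 q h}}}} small ⟩
    4 ^ h * (q ^ h) ^ m           ∎)

-- Boxes of subsets and their weights

data Constraint : Set where
  forced : Bool → Constraint
  free   : Constraint

data Satisfies : Bool → Constraint → Set where
  forced : ∀ {b} → Satisfies b (forced b)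
  free   : ∀ {b} → Satisfies b free

satisfies? : ∀ b c → Dec (Satisfies b c)
satisfies? true  (forced true)  = yes forced
satisfies? false (forced false) = yes forced
satisfies? true  (forced false) = no λ ()
satisfies? false (forced true)  = no λ ()
satisfies? b     free           = yes free

Box : ℕ → Set
Box = Vec.Vec Constraint

_∈ᵇ_ : ∀ {n} → Subset n → Box n → Set
S ∈ᵇ B = Pointwise Satisfies S B

_∉ᵇ_ : ∀ {n} → Subset n → Box n → Set
S ∉ᵇ B = ¬ S ∈ᵇ B

superBox : ∀ {n} → Subset n → Box n
superBox []            = []
superBox (inside ∷ G)  = forced true ∷ superBox G
superBox (outside ∷ G) = free ∷ superBox G

subBox : ∀ {n} → Subset n → Box n
subBox []            = []
subBox (inside ∷ B)  = free ∷ subBox B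
subBox (outside ∷ B) = forced false ∷ subBox B

⊆⇒∈superBox : ∀ {n} {G S : Subset n} → G ⊆ S → S ∈ᵇ superBox G
⊆⇒∈superBox {G = []}          {[]}    _   = []
⊆⇒∈superBox {G = inside ∷ G}  {s ∷ S} G⊆S with G⊆S here
... | here = forced ∷ ⊆⇒∈superBox (drop-∷-⊆ G⊆S)
⊆⇒∈superBox {G = outside ∷ G} {s ∷ S} G⊆S = free ∷ ⊆⇒∈superBox (drop-∷-⊆ G⊆S)

⊆⇒∈subBox : ∀ {n} {S B : Subset n} → S ⊆ B → S ∈ᵇ subBox B
⊆⇒∈subBox {S = []}          {[]}          _   = []
⊆⇒∈subBox {S = s ∷ S}       {inside ∷ B}  S⊆B = free ∷ ⊆⇒∈subBox (drop-∷-⊆ S⊆B)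
⊆⇒∈subBox {S = outside ∷ S} {outside ∷ B} S⊆B = forced ∷ ⊆⇒∈subBox (drop-∷-⊆ S⊆B)
⊆⇒∈subBox {S = inside ∷ S}  {outside ∷ B} S⊆B with S⊆B here
... | ()

-- For a random S containing each point independently with probability 1/(1 + r),
-- boxWeight B = (1 + r)^n · Pr[S ∈ᵇ B].
module Weights (r : ℕ) where

  constraintWeight : Constraint → ℕ
  constraintWeight (forced true)  = 1
  constraintWeight (forced false) = r
  constraintWeight free           = suc r

  boxWeight : ∀ {n} → Box n → ℕ
  boxWeight []      = 1
  boxWeight (c ∷ B) = constraintWeight c * boxWeight B

  totalWeight : ∀ {n} → List (Box n) → ℕ
  totalWeight Bs = sum (map boxWeight Bs)

  restrict : ∀ {n} → Bool → List (Box (suc n)) → List (Box n)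
  restrict b []             = []
  restrict b ((c ∷ B) ∷ Bs) with satisfies? b c
  ... | yes _ = B ∷ restrict b Bs
  ... | no _  = restrict b Bs

  totalWeight-restrict : ∀ {n} (Bs : List (Box (suc n))) →
    totalWeight Bs ≡ totalWeight (restrict true Bs) + r * totalWeight (restrict false Bs)
  totalWeight-restrict [] = sym (*-zeroʳ r)
  totalWeight-restrict ((forced true ∷ B) ∷ Bs) =
    trans (cong (1 * boxWeight B +_) (totalWeight-restrict Bs)) (true-step r (boxWeight B) _ _)
    where
    true-step : ∀ r w t f → 1 * w + (t + r * f) ≡ (w + t) + r * f
    true-step = solve-∀
  totalWeight-restrict ((forced false ∷ B) ∷ Bs) =
    trans (cong (r * boxWeight B +_) (totalWeight-restrict Bs)) (false-step r (boxWeight B) _ _)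
    where
    false-step : ∀ r w t f → r * w + (t + r * f) ≡ t + r * (w + f)
    false-step = solve-∀
  totalWeight-restrict ((free ∷ B) ∷ Bs) =
    trans (cong (suc r * boxWeight B +_) (totalWeight-restrict Bs)) (free-step r (boxWeight B) _ _)
    where
    free-step : ∀ r w t f → (1 + r) * w + (t + r * f) ≡ (w + t) + r * (w + f)
    free-step = solve-∀

  avoid-restrict : ∀ {n} b {S : Subset n} (Bs : List (Box (suc n))) →
                   All (S ∉ᵇ_) (restrict b Bs) → All ((b ∷ S) ∉ᵇ_) Bs
  avoid-restrict b []             [] = []
  avoid-restrict b ((c ∷ B) ∷ Bs) avoids with satisfies? b c
  avoid-restrict b ((c ∷ B) ∷ Bs) (S∉B ∷ avoids) | yes _ =
    (λ { (_ ∷ S∈B) → S∉B S∈B }) ∷ avoid-restrict b Bs avoids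
  avoid-restrict b ((c ∷ B) ∷ Bs) avoids         | no b⊭c =
    (λ { (b⊨c ∷ _) → b⊭c b⊨c }) ∷ avoid-restrict b Bs avoids

  -- Union bound, derandomised: the weight budget (1 + r)^(n+1) splits as (1 + r)^n for the
  -- boxes admitting S ∋ 0 plus r·(1 + r)^n for those admitting S ∌ 0, so one side stays light.
  avoid : ∀ n (Bs : List (Box n)) → totalWeight Bs < suc r ^ n → Σ (Subset n) λ S → All (S ∉ᵇ_) Bs
  avoid zero    []       _        = [] , []
  avoid zero    ([] ∷ _) (s≤s ())
  avoid (suc n) Bs       light with totalWeight (restrict true Bs) <? suc r ^ n
  ... | yes lightᵗ =
    let S , avoids = avoid n (restrict true Bs) lightᵗ in inside ∷ S , avoid-restrict true Bs avoids
  ... | no heavyᵗ  =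
    let S , avoids = avoid n (restrict false Bs) lightᶠ in outside ∷ S , avoid-restrict false Bs avoids
    where
    lightᶠ : totalWeight (restrict false Bs) < suc r ^ n
    lightᶠ = *-cancelˡ-< r _ _ (+-cancelˡ-< (suc r ^ n) _ _ (begin-strict
      suc r ^ n + r * totalWeight (restrict false Bs)                      ≤⟨ +-monoˡ-≤ _ (≮⇒≥ heavyᵗ) ⟩
      totalWeight (restrict true Bs) + r * totalWeight (restrict false Bs) ≡⟨ totalWeight-restrict Bs ⟨
      totalWeight Bs                                                       <⟨ light ⟩
      suc r ^ n + r * suc r ^ n                                            ∎))
      where open ≤-Reasoning

  superBox-weight : ∀ {n} (G : Subset n) → boxWeight (superBox G) * suc r ^ ∣ G ∣ ≡ suc r ^ n
  superBox-weight []                   = refl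
  superBox-weight {suc n} (inside ∷ G) = begin
    1 * w * (suc r * suc r ^ ∣ G ∣) ≡⟨ cong (_* (suc r * suc r ^ ∣ G ∣)) (*-identityˡ w) ⟩
    w * (suc r * suc r ^ ∣ G ∣)     ≡⟨ x∙yz≈y∙xz w (suc r) (suc r ^ ∣ G ∣) ⟩
    suc r * (w * suc r ^ ∣ G ∣)     ≡⟨ cong (suc r *_) (superBox-weight G) ⟩
    suc r * suc r ^ n               ∎
    where
    open ≡-Reasoning
    w = boxWeight (superBox G)
  superBox-weight (outside ∷ G) =
    trans (*-assoc (suc r) (boxWeight (superBox G)) (suc r ^ ∣ G ∣)) (cong (suc r *_) (superBox-weight G))

  subBox-weight : ∀ {n} (B : Subset n) → boxWeight (subBox B) * suc r ^ ∣ ∁ B ∣ ≡ r ^ ∣ ∁ B ∣ * suc r ^ n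
  subBox-weight []                   = refl
  subBox-weight {suc n} (inside ∷ B) = begin
    suc r * w * suc r ^ ∣ ∁ B ∣     ≡⟨ *-assoc (suc r) w (suc r ^ ∣ ∁ B ∣) ⟩
    suc r * (w * suc r ^ ∣ ∁ B ∣)   ≡⟨ cong (suc r *_) (subBox-weight B) ⟩
    suc r * (r ^ ∣ ∁ B ∣ * suc r ^ n) ≡⟨ x∙yz≈y∙xz (suc r) (r ^ ∣ ∁ B ∣) (suc r ^ n) ⟩
    r ^ ∣ ∁ B ∣ * (suc r * suc r ^ n) ∎
    where
    open ≡-Reasoning
    w = boxWeight (subBox B)
  subBox-weight {suc n} (outside ∷ B) = begin
    r * w * (suc r * suc r ^ ∣ ∁ B ∣)     ≡⟨ rearrange r w (suc r) (suc r ^ ∣ ∁ B ∣) ⟩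
    r * (suc r * (w * suc r ^ ∣ ∁ B ∣))   ≡⟨ cong (λ t → r * (suc r * t)) (subBox-weight B) ⟩
    r * (suc r * (r ^ ∣ ∁ B ∣ * suc r ^ n)) ≡⟨ rearrange′ r (suc r) (r ^ ∣ ∁ B ∣) (suc r ^ n) ⟩
    r * r ^ ∣ ∁ B ∣ * (suc r * suc r ^ n)   ∎
    where
    open ≡-Reasoning
    w = boxWeight (subBox B)
    rearrange : ∀ r w q x → r * w * (q * x) ≡ r * (q * (w * x))
    rearrange = solve-∀
    rearrange′ : ∀ r q y z → r * (q * (y * z)) ≡ r * y * (q * z)
    rearrange′ = solve-∀

∣⁅x⁆∪p∣≡1+∣p∣ : ∀ {n} (x : Fin n) (p : Subset n) → x ∉ p → ∣ ⁅ x ⁆ ∪ p ∣ ≡ suc ∣ p ∣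
∣⁅x⁆∪p∣≡1+∣p∣ zero    (outside ∷ p) _   = cong (suc ∘ ∣_∣) (∪-identityˡ p)
∣⁅x⁆∪p∣≡1+∣p∣ zero    (inside ∷ p)  x∉p = ⊥-elim (x∉p here)
∣⁅x⁆∪p∣≡1+∣p∣ (suc x) (outside ∷ p) x∉p = ∣⁅x⁆∪p∣≡1+∣p∣ x p (x∉p ∘ there)
∣⁅x⁆∪p∣≡1+∣p∣ (suc x) (inside ∷ p)  x∉p = cong suc (∣⁅x⁆∪p∣≡1+∣p∣ x p (x∉p ∘ there))

module _ {n : ℕ} where

  fromDec : {P : Fin n → Set} → Decidable P → Subset n
  fromDec P? = Vec.tabulate (does ∘ P?)

  module _ {P : Fin n → Set} (P? : Decidable P) where

    ∈-fromDec⁺ : ∀ {x} → P x → x ∈ fromDec P?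
    ∈-fromDec⁺ {x} px = lookup⇒[]= x _ (trans (lookup∘tabulate (does ∘ P?) x) (dec-true (P? x) px))

    ∈-fromDec⁻ : ∀ {x} → x ∈ fromDec P? → P x
    ∈-fromDec⁻ {x} x∈ with P? x | trans (sym (lookup∘tabulate (does ∘ P?) x)) ([]=⇒lookup x∈)
    ... | yes px | _  = px
    ... | no _   | ()

  ⊈⇒∃ : ∀ {A B : Subset n} → ¬ A ⊆ B → ∃ λ p → p ∈ A × p ∉ B
  ⊈⇒∃ {A} {B} A⊈B with any? (λ p → (p ∈? A) ×-dec ¬? (p ∈? B))
  ... | yes witness = witness
  ... | no ¬witness =
    contradiction (λ {p} p∈A → decidable-stable (p ∈? B) (λ p∉B → ¬witness (p , p∈A , p∉B))) A⊈B

  elements : Subset n → List (Fin n)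
  elements A = filter (_∈? A) (allFin n)

  ∈-elements : ∀ {A p} → p ∈ A → p ∈ₗ elements A
  ∈-elements p∈A = ∈-filter⁺ (_∈? _) (∈-allFin _) p∈A

private
  count-∈-tabulate-suc : ∀ {k n} b (p : Subset n) (g : Fin k → Fin n) →
                         count (_∈? (b ∷ p)) (tabulate (suc ∘ g)) ≡ count (_∈? p) (tabulate g)
  count-∈-tabulate-suc {zero}  b p g = refl
  count-∈-tabulate-suc {suc k} b p g with g zero ∈? p
  ... | yes _ = cong suc (count-∈-tabulate-suc b p (g ∘ suc))
  ... | no _  = count-∈-tabulate-suc b p (g ∘ suc)

length-elements : ∀ {n} (p : Subset n) → length (elements p) ≡ ∣ p ∣
length-elements []            = refl
length-elements (inside ∷ p)  =
  cong suc (trans (count-∈-tabulate-suc inside p (λ x → x)) (length-elements p))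
length-elements (outside ∷ p) = trans (count-∈-tabulate-suc outside p (λ x → x)) (length-elements p)

-- Compatibility and transversals in a finite poset

module _ {n : ℕ} (P : FinPoset n) where
  open FinPoset P
  open IsPartialOrder isPartialOrder using () renaming (refl to ≼-refl; trans to ≼-trans)

  up : Fin n → List (Fin n)
  up x = filter (x ≼?_) (allFin n)

  ∈-up⁺ : ∀ {x y} → x ≼ y → y ∈ₗ up x
  ∈-up⁺ x≼y = ∈-filter⁺ (_ ≼?_) (∈-allFin _) x≼y

  ∈-up⁻ : ∀ {x y} → y ∈ₗ up x → x ≼ y
  ∈-up⁻ y∈ = proj₂ (∈-filter⁻ (_ ≼?_) {xs = allFin n} y∈)

  size≤mP : ∀ p → downSize P p + upSize P p ≤ mP P
  size≤mP p = ∈⇒≤foldr-⊔ (∈-map⁺ (λ p → downSize P p + upSize P p) (∈-allFin p))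

  mP-nonZero : Fin n → NonZero (mP P)
  mP-nonZero p = >-nonZero (begin
    1                           ≤⟨ filter-some (p ≼?_) (lose (∈-allFin p) ≼-refl) ⟩
    upSize P p                  ≤⟨ m≤n+m _ _ ⟩
    downSize P p + upSize P p   ≤⟨ size≤mP p ⟩
    mP P                        ∎)
    where open ≤-Reasoning

  Compatible : Fin n → Fin n → Set
  Compatible x y = ∃ λ z → x ≼ z × y ≼ z

  compatible? : ∀ x → Decidable (Compatible x)
  compatible? x y = any? (λ z → (x ≼? z) ×-dec (y ≼? z))

  compatible-refl : ∀ x → Compatible x x
  compatible-refl x = x , ≼-refl , ≼-refl

  compatible-sym : ∀ {x y} → Compatible x y → Compatible y x
  compatible-sym (z , x≼z , y≼z) = z , y≼z , x≼z

  Independent : List (Fin n) → Set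
  Independent = AllPairs (λ x y → ¬ Compatible x y)

  record MaximalIndependent (xs : List (Fin n)) : Set where
    field
      centres     : List (Fin n)
      centres⊑    : centres ⊑ xs
      independent : Independent centres
      dominating  : All (λ x → Any (Compatible x) centres) xs

  maximalIndependent : ∀ xs → MaximalIndependent xs
  maximalIndependent [] = record { centres = [] ; centres⊑ = [] ; independent = [] ; dominating = [] }
  maximalIndependent (x ∷ xs) with maximalIndependent xs
  ... | record { centres = cs ; centres⊑ = cs⊑ ; independent = indep ; dominating = dom }
    with Any.any? (compatible? x) cs
  ... | yes x-dominated = record
    { centres = cs ; centres⊑ = x ∷ʳ cs⊑ ; independent = indep ; dominating = x-dominated ∷ dom }
  ... | no x-free = record
    { centres     = x ∷ cs
    ; centres⊑    = refl ∷ cs⊑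
    ; independent = AllP.¬Any⇒All¬ cs x-free ∷ indep
    ; dominating  = here (compatible-refl x) ∷ All.map there dom
    }

  Below : Subset n → Fin n → Set
  Below S p = ∃ λ s → s ∈ S × p ≼ s

  below? : ∀ S → Decidable (Below S)
  below? S p = any? (λ s → (s ∈? S) ×-dec (p ≼? s))

  downClosure : Subset n → Subset n
  downClosure S = fromDec (below? S)

  ∈-downClosure⁻ : ∀ {S p} → p ∈ downClosure S → Below S p
  ∈-downClosure⁻ {S} = ∈-fromDec⁻ (below? S)

  ⊆-downClosure : ∀ {S} → S ⊆ downClosure S
  ⊆-downClosure {S} {s} s∈S = ∈-fromDec⁺ (below? S) (s , s∈S , ≼-refl)

  downClosure-isDownset : ∀ S → IsDownset P (downClosure S)
  downClosure-isDownset S p q q≼p p∈ with s , s∈S , p≼s ← ∈-downClosure⁻ p∈ =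
    ∈-fromDec⁺ (below? S) (s , s∈S , ≼-trans q≼p p≼s)

  transversals : List (Fin n) → List (Subset n)
  transversals []       = ∅ ∷ []
  transversals (x ∷ xs) = cartesianProductWith (λ s G → ⁅ s ⁆ ∪ G) (up x) (transversals xs)

  transversal-⊆ : ∀ {S} xs → All (Below S) xs → Any (_⊆ S) (transversals xs)
  transversal-⊆ {S} []       []                           = here (⊆-min S)
  transversal-⊆ {S} (x ∷ xs) ((s , s∈S , x≼s) ∷ dominated) =
    AnyP.cartesianProductWith⁺ _ insert-⊆ (lose (∈-up⁺ x≼s) s∈S) (transversal-⊆ xs dominated)
    where
    insert-⊆ : ∀ {s G} → s ∈ S → G ⊆ S → ⁅ s ⁆ ∪ G ⊆ S
    insert-⊆ {s} {G} s∈S G⊆S p∈ =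
      [ (λ p∈⁅s⁆ → subst (_∈ S) (sym (x∈⁅y⁆⇒x≡y s p∈⁅s⁆)) s∈S) , G⊆S ]′ (x∈p∪q⁻ ⁅ s ⁆ G p∈)

  -- The second component keeps the inserted points fresh: independent centres have disjoint up-sets.
  transversal-invariant : ∀ {xs} → Independent xs →
                          All (λ G → ∣ G ∣ ≡ length xs × (∀ {p} → p ∈ G → Any (_≼ p) xs)) (transversals xs)
  transversal-invariant {[]}     []                = (∣⊥∣≡0 n , λ p∈∅ → ⊥-elim (∉⊥ p∈∅)) ∷ []
  transversal-invariant {x ∷ xs} (x-indep ∷ indep) =
    AllP.cartesianProductWith⁺ (setoid _) (setoid _) _ (up x) (transversals xs) insert
    where
    insert : ∀ {s G} → s ∈ₗ up x → G ∈ₗ transversals xs →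
             ∣ ⁅ s ⁆ ∪ G ∣ ≡ suc (length xs) × (∀ {p} → p ∈ ⁅ s ⁆ ∪ G → Any (_≼ p) (x ∷ xs))
    insert {s} {G} s∈up G∈ with ∣G∣ , G-above ← All.lookup (transversal-invariant indep) G∈ =
      trans (∣⁅x⁆∪p∣≡1+∣p∣ s G s∉G) (cong suc ∣G∣) , above
      where
      s∉G : s ∉ G
      s∉G s∈G = All.lookupWith (λ x≁y y≼s → x≁y (s , ∈-up⁻ s∈up , y≼s)) x-indep (G-above s∈G)
      above : ∀ {p} → p ∈ ⁅ s ⁆ ∪ G → Any (_≼ p) (x ∷ xs)
      above {p} p∈ =
        [ (λ p∈⁅s⁆ → here (subst (x ≼_) (sym (x∈⁅y⁆⇒x≡y s p∈⁅s⁆)) (∈-up⁻ s∈up))) , there ∘ G-above ]′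
          (x∈p∪q⁻ ⁅ s ⁆ G p∈)

  ∣transversal∣≡length : ∀ {xs} → Independent xs → All (λ G → ∣ G ∣ ≡ length xs) (transversals xs)
  ∣transversal∣≡length indep = All.map proj₁ (transversal-invariant indep)

  module _ {m} (bounded : ∀ p → downSize P p + upSize P p ≤ m) where

    upSize≤ : ∀ p → upSize P p ≤ m
    upSize≤ p = ≤-trans (m≤n+m _ _) (bounded p)

    downSize≤ : ∀ p → downSize P p ≤ m
    downSize≤ p = ≤-trans (m≤m+n _ _) (bounded p)

    count-compatible≤ : ∀ x → count (compatible? x) (allFin n) ≤ m * m
    count-compatible≤ x = begin
      count (compatible? x) (allFin n)
        ≤⟨ count-mono (compatible? x) (covered? (λ z y → y ≼? z) (up x))
             (λ (z , x≼z , y≼z) → lose (∈-up⁺ x≼z) y≼z) (⊆-refl {x = allFin n}) ⟩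
      count (covered? (λ z y → y ≼? z) (up x)) (allFin n)
        ≤⟨ count-covered≤sum (λ z y → y ≼? z) (up x) (allFin n) ⟩
      sum (map (downSize P) (up x))
        ≤⟨ sum-map-≤ (downSize P) (All.universal downSize≤ (up x)) ⟩
      upSize P x * m
        ≤⟨ *-monoˡ-≤ m (upSize≤ x) ⟩
      m * m ∎
      where open ≤-Reasoning

    ∣elements∣≤∣centres∣*m² : ∀ {A} (mi : MaximalIndependent (elements A)) →
                               length (elements A) ≤ length (MaximalIndependent.centres mi) * (m * m)
    ∣elements∣≤∣centres∣*m² {A} mi = begin
      count (_∈? A) (allFin n)
        ≤⟨ count-mono (_∈? A) (covered? compatible? centres)
             (λ p∈A → Any.map compatible-sym (All.lookup dominating (∈-elements p∈A)))
             (⊆-refl {x = allFin n}) ⟩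
      count (covered? compatible? centres) (allFin n)
        ≤⟨ count-covered≤sum compatible? centres (allFin n) ⟩
      sum (map (λ c → count (compatible? c) (allFin n)) centres)
        ≤⟨ sum-map-≤ _ (All.universal count-compatible≤ centres) ⟩
      length centres * (m * m) ∎
      where
      open ≤-Reasoning
      open MaximalIndependent mi

    length-transversals : ∀ xs → length (transversals xs) ≤ m ^ length xs
    length-transversals []       = ≤-refl
    length-transversals (x ∷ xs) = begin
      length (transversals (x ∷ xs))           ≡⟨ length-cartesianProductWith _ (up x) (transversals xs) ⟩
      length (up x) * length (transversals xs) ≤⟨ *-mono-≤ (upSize≤ x) (length-transversals xs) ⟩
      m * m ^ length xs                        ∎
      where open ≤-Reasoning

-- Dual families in which every point is rare

module AllPointsRare {n : ℕ} (P : FinPoset n) (𝒜 ℬ : List (Subset n)) where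

  N : ℕ
  N = length 𝒜 + length ℬ

  module _ {m} .{{_ : NonZero m}} (bounded : ∀ p → downSize P p + upSize P p ≤ m)
           (𝒜≢[] : 1 ≤ length 𝒜) (ℬ≢[] : 1 ≤ length ℬ) (dual : Dual P 𝒜 ℬ)
           (rare-in-𝒜 : ∀ p → ¬ FreqBound (length 𝒜) (countIn 𝒜 p) m N)
           (rare-outside-ℬ : ∀ p → ¬ FreqBound (length ℬ) (countOut ℬ p) (m * m) N) where

    -- Points are drawn with probability 1/(1 + r) = 1/(2m).
    r : ℕ
    r = m + pred m

    1+r≡2*m : suc r ≡ 2 * m
    1+r≡2*m = trans (sym (+-suc m (pred m))) (cong (m +_) (trans (suc-pred m) (sym (+-identityʳ m))))

    open Weights r

    A⊈B : ∀ {A B} → A ∈ₗ 𝒜 → B ∈ₗ ℬ → ∃ λ p → p ∈ A × p ∉ B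
    A⊈B A∈ B∈ = ⊈⇒∃ (proj₁ dual A∈ B∈)

    subBox-light : ∀ {B} → B ∈ₗ ℬ → N * boxWeight (subBox B) < suc r ^ n
    subBox-light {B} B∈ = *-cancelˡ-< (suc r ^ h) _ _ (begin-strict
      suc r ^ h * (N * boxWeight (subBox B)) ≡⟨ x∙yz≈y∙zx (suc r ^ h) N _ ⟩
      N * (boxWeight (subBox B) * suc r ^ h) ≡⟨ cong (N *_) (subBox-weight B) ⟩
      N * (r ^ h * suc r ^ n)                ≡⟨ x∙yz≈yx∙z N (r ^ h) (suc r ^ n) ⟩
      r ^ h * N * suc r ^ n                  <⟨ *-monoˡ-< (suc r ^ n) {{m^n≢0 (suc r) n}} r^h*N<[1+r]^h ⟩
      suc r ^ h * suc r ^ n                  ∎)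
      where
      open ≤-Reasoning
      h = ∣ ∁ B ∣
      hits : All (λ A → Any (_∈ A) (elements (∁ B))) 𝒜
      hits = All.tabulate λ A∈ → let p , p∈A , p∉B = A⊈B A∈ B∈ in lose (∈-elements (x∉p⇒x∈∁p p∉B)) p∈A
      r^h*N<[1+r]^h : r ^ h * N < suc r ^ h
      r^h*N<[1+r]^h with p , 𝒜≤ ← pigeonhole _∈?_ (elements (∁ B)) 𝒜 hits 𝒜≢[] =
        3^h*N^m<4^h⇒r^h*N<[1+r]^h h N m r small (bernoulli-¾ m)
        where
        small : 3 ^ h * N ^ m < 4 ^ h
        small = subst (λ h → 3 ^ h * N ^ m < 4 ^ h) (length-elements (∁ B))
                  (¬FreqBound⇒3^h*N^k<4^h (length 𝒜) (countIn 𝒜 p) m N (length (elements (∁ B)))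
                     (rare-in-𝒜 p) 𝒜≤)

    centres : Subset n → List (Fin n)
    centres A = MaximalIndependent.centres (maximalIndependent P (elements A))

    centres⊆ : ∀ A → All (_∈ A) (centres A)
    centres⊆ A = All-resp-⊆ (MaximalIndependent.centres⊑ (maximalIndependent P (elements A)))
                            (AllP.all-filter (_∈? A) (allFin n))

    transversalBoxes : Subset n → List (Box n)
    transversalBoxes A = map superBox (transversals P (centres A))

    transversalBoxes-light : ∀ {A} → A ∈ₗ 𝒜 → N * totalWeight (transversalBoxes A) < suc r ^ n
    transversalBoxes-light {A} A∈ = *-cancelˡ-< (suc r ^ k) _ _ (begin-strict
      suc r ^ k * (N * W)         ≡⟨ x∙yz≈y∙zx (suc r ^ k) N W ⟩
      N * (W * suc r ^ k)         ≡⟨ cong (N *_) weights ⟩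
      N * (length Gs * suc r ^ n) ≤⟨ *-monoʳ-≤ N (*-monoˡ-≤ (suc r ^ n) ∣Gs∣≤m^k) ⟩
      N * (m ^ k * suc r ^ n)     <⟨ *-monoˡ-< (m ^ k * suc r ^ n) {{m^k*q^n≢0}} N<2^k ⟩
      2 ^ k * (m ^ k * suc r ^ n) ≡⟨ *-assoc (2 ^ k) (m ^ k) (suc r ^ n) ⟨
      2 ^ k * m ^ k * suc r ^ n   ≡⟨ cong (_* suc r ^ n) (^-distribʳ-* 2 m k) ⟨
      (2 * m) ^ k * suc r ^ n     ≡⟨ cong (λ q → q ^ k * suc r ^ n) 1+r≡2*m ⟨
      suc r ^ k * suc r ^ n       ∎)
      where
      open ≤-Reasoning
      mi = maximalIndependent P (elements A)
      open MaximalIndependent mi using (independent)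
      k = length (centres A)
      Gs = transversals P (centres A)
      W = totalWeight (transversalBoxes A)

      ∣Gs∣≤m^k : length Gs ≤ m ^ k
      ∣Gs∣≤m^k = length-transversals P bounded (centres A)

      m^k*q^n≢0 : NonZero (m ^ k * suc r ^ n)
      m^k*q^n≢0 = m*n≢0 (m ^ k) (suc r ^ n) {{m^n≢0 m k}} {{m^n≢0 (suc r) n}}

      weights : W * suc r ^ k ≡ length Gs * suc r ^ n
      weights = begin-equality
        W * suc r ^ k
          ≡⟨ sum-map-*-const boxWeight (AllP.map⁺ (All.map (λ {G} → weight G) ∣Gs∣≡k)) ⟩
        length (map superBox Gs) * suc r ^ n
          ≡⟨ cong (_* suc r ^ n) (length-map superBox Gs) ⟩
        length Gs * suc r ^ n ∎
        where
        ∣Gs∣≡k = ∣transversal∣≡length P independent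
        weight : ∀ G → ∣ G ∣ ≡ k → boxWeight (superBox G) * suc r ^ k ≡ suc r ^ n
        weight G ∣G∣≡k =
          subst (λ j → boxWeight (superBox G) * suc r ^ j ≡ suc r ^ n) ∣G∣≡k (superBox-weight G)

      misses : All (λ B → Any (_∉ B) (elements A)) ℬ
      misses = All.tabulate λ B∈ → let p , p∈A , p∉B = A⊈B A∈ B∈ in lose (∈-elements p∈A) p∉B

      N<2^k : N < 2 ^ k
      N<2^k with p , ℬ≤ ← pigeonhole (λ p B → ¬? (p ∈? B)) (elements A) ℬ misses ℬ≢[] =
        3^h*N^M<4^h⇒N<2^k (length (elements A)) N (m * m) k small (∣elements∣≤∣centres∣*m² P bounded mi)
        where
        small : 3 ^ length (elements A) * N ^ (m * m) < 4 ^ length (elements A)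
        small = ¬FreqBound⇒3^h*N^k<4^h (length ℬ) (countOut ℬ p) (m * m) N (length (elements A))
                  (rare-outside-ℬ p) ℬ≤

    clauses : List (Subset n ⊎ Subset n)
    clauses = map inj₁ 𝒜 ++ map inj₂ ℬ

    length-clauses : length clauses ≡ N
    length-clauses = trans (length-++ (map inj₁ 𝒜)) (cong₂ _+_ (length-map inj₁ 𝒜) (length-map inj₂ ℬ))

    clauseBoxes : Subset n ⊎ Subset n → List (Box n)
    clauseBoxes (inj₁ A) = transversalBoxes A
    clauseBoxes (inj₂ B) = subBox B ∷ []

    boxes : List (Box n)
    boxes = concatMap clauseBoxes clauses

    boxes-light : totalWeight boxes < suc r ^ n
    boxes-light = begin-strict
      totalWeight boxes                             ≡⟨ sum-map-concatMap boxWeight clauseBoxes clauses ⟩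
      sum (map (totalWeight ∘ clauseBoxes) clauses) <⟨ sum-map-<-average _ clauses 1≤length light ⟩
      suc r ^ n                                     ∎
      where
      open ≤-Reasoning
      1≤length : 1 ≤ length clauses
      1≤length = subst (1 ≤_) (sym length-clauses) (≤-trans 𝒜≢[] (m≤m+n _ _))
      light : All (λ c → length clauses * totalWeight (clauseBoxes c) < suc r ^ n) clauses
      light rewrite length-clauses = AllP.++⁺
        (AllP.map⁺ (All.tabulate transversalBoxes-light))
        (AllP.map⁺ (All.tabulate λ B∈ →
          subst (λ w → N * w < suc r ^ n) (sym (+-identityʳ _)) (subBox-light B∈)))

    clauseBoxes-cover : ∀ S → ¬ All (λ c → All (S ∉ᵇ_) (clauseBoxes c)) clauses
    clauseBoxes-cover S avoids with proj₂ dual (downClosure P S) (downClosure-isDownset P S)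
    ... | inj₁ (A , A∈ , A⊆↓S) =
      All.lookupWith S∉⇒⊈ (AllP.map⁻ (All.lookup avoids (∈-++⁺ˡ (∈-map⁺ inj₁ A∈))))
        (transversal-⊆ P (centres A) (All.map (∈-downClosure⁻ P ∘ A⊆↓S) (centres⊆ A)))
      where
      S∉⇒⊈ : ∀ {G} → S ∉ᵇ superBox G → ¬ G ⊆ S
      S∉⇒⊈ S∉ G⊆S = S∉ (⊆⇒∈superBox G⊆S)
    ... | inj₂ (B , B∈ , ↓S⊆B) =
      All.head (All.lookup avoids (∈-++⁺ʳ (map inj₁ 𝒜) (∈-map⁺ inj₂ B∈)))
        (⊆⇒∈subBox (↓S⊆B ∘ ⊆-downClosure P))

    absurd : ⊥
    absurd = let S , avoids = avoid n boxes boxes-light in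
             clauseBoxes-cover S (AllP.map⁻ (AllP.concat⁻ avoids))

dual⇒point : ∀ {n} (P : FinPoset n) {𝒜 ℬ} → 1 ≤ length 𝒜 → 1 ≤ length ℬ → Dual P 𝒜 ℬ → Fin n
dual⇒point P {A ∷ _} {B ∷ _} _ _ dual = proj₁ (⊈⇒∃ (proj₁ dual (here refl) (here refl)))

freqBound? : ∀ a c k N → Dec (FreqBound a c k N)
freqBound? a c k N = 4 ^ a ≤? 3 ^ a * N ^ (k * c)

corollary4 : (n : ℕ) (P : FinPoset n) (𝒜 ℬ : List (Subset n)) →
    IsAntichainL P 𝒜 → IsAntichainL P ℬ →
    length 𝒜 ≥ 1 → length ℬ ≥ 1 →
    Dual P 𝒜 ℬ →
    (Σ (Fin n) λ p → FreqBound (length 𝒜) (countIn 𝒜 p) (mP P) (length 𝒜 + length ℬ))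
    ⊎ (Σ (Fin n) λ p → FreqBound (length ℬ) (countOut ℬ p) (mP P * mP P) (length 𝒜 + length ℬ))
corollary4 n P 𝒜 ℬ _ _ 𝒜≢[] ℬ≢[] dual
  with any? (λ p → freqBound? (length 𝒜) (countIn 𝒜 p) (mP P) (length 𝒜 + length ℬ))
     | any? (λ p → freqBound? (length ℬ) (countOut ℬ p) (mP P * mP P) (length 𝒜 + length ℬ))
... | yes frequent | _            = inj₁ frequent
... | no _         | yes frequent = inj₂ frequent
... | no rare₁     | no rare₂     =
  ⊥-elim (AllPointsRare.absurd P 𝒜 ℬ {{mP-nonZero P (dual⇒point P 𝒜≢[] ℬ≢[] dual)}} (size≤mP P)
            𝒜≢[] ℬ≢[] dual (λ p → rare₁ ∘ (p ,_)) (λ p → rare₂ ∘ (p ,_)))
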